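{- For every integer $n\geq 0$, $$\sum_{k=0}^n \binom{n}{k}(3\sqrt{5})^{n-k}\bigl(2^{1-(n-k)}-1\bigr)F_{4k}\,B_{n-k} = 3n\Bigl(\frac{7}{2}\Bigr)^{n-1}.$$
   Context: $B_n$ denotes the $n$-th Bernoulli number, defined by $\sum_{n\ge0}B_n\frac{z^n}{n!}=\frac{z}{e^z-1}$ (so $B_1=-1/2$). $F_n$ denotes the Fibonacci numbers: $F_0=0$, $F_1=1$, $F_n=F_{n-1}+F_{n-2}$. -}

module Defs where

open import Data.Nat as ℕ using (ℕ; zero; suc)
open import Data.Nat.Combinatorics using (_C_)
open import Data.Integer as ℤ using (+_)
open import Data.Rational as ℚ using (ℚ; _/_; ½)
open import Data.Vec using (Vec; []; _∷_; _∷ʳ_; last; lookup; tabulate; foldr)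
open import Data.Fin using (Fin; toℕ)

ℕ→ℚ : ℕ → ℚ
ℕ→ℚ n = + n / 1

_^ℚ_ : ℚ → ℕ → ℚ
x ^ℚ zero = ℚ.1ℚ
x ^ℚ suc n = x ℚ.* (x ^ℚ n)

fib : ℕ → ℕ
fib zero = 0
fib (suc zero) = 1
fib (suc (suc n)) = fib (suc n) ℕ.+ fib n

sumℚ : (n : ℕ) → (ℕ → ℚ) → ℚ
sumℚ zero f = f 0
sumℚ (suc n) f = sumℚ n f ℚ.+ f (suc n)

-- Bernoulli numbers (convention B₁ = -1/2), via the recurrence equivalent to
-- z/(e^z-1) = Σ Bₙ zⁿ/n!, i.e. Σ_{k=0}^{m} C(m+1,k) B_k = 0 for m ≥ 1, B₀ = 1:
--   B_m = -(1/(m+1)) Σ_{k<m} C(m+1,k) B_k.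
-- bernVec m = [B₀, …, B_m]
bernNext : (m : ℕ) → Vec ℚ m → ℚ
bernNext m bs =
  ℚ.- ((+ 1 / suc m) ℚ.* foldr (λ _ → ℚ) ℚ._+_ ℚ.0ℚ
        (tabulate (λ (i : Fin m) → ℕ→ℚ (suc m C toℕ i) ℚ.* lookup bs i)))

bernVec : (m : ℕ) → Vec ℚ (suc m)
bernVec zero = ℚ.1ℚ ∷ []
bernVec (suc m) = bernVec m ∷ʳ bernNext (suc m) (bernVec m)

bernoulli : ℕ → ℚ
bernoulli m = last (bernVec m)

record ℚ√5 : Set where
  constructor _+_√5
  field
    re : ℚ
    im : ℚ

infixl 6 _⊕_
infixl 7 _⊗_

_⊕_ : ℚ√5 → ℚ√5 → ℚ√5
(a + b √5) ⊕ (c + d √5) = (a ℚ.+ c) + (b ℚ.+ d) √5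

_⊗_ : ℚ√5 → ℚ√5 → ℚ√5
(a + b √5) ⊗ (c + d √5) =
  (a ℚ.* c ℚ.+ ℕ→ℚ 5 ℚ.* (b ℚ.* d)) + (a ℚ.* d ℚ.+ b ℚ.* c) √5

ι : ℚ → ℚ√5
ι a = a + ℚ.0ℚ √5

zero√5 : ℚ√5
zero√5 = ι ℚ.0ℚ

one√5 : ℚ√5
one√5 = ι ℚ.1ℚ

_^√5_ : ℚ√5 → ℕ → ℚ√5
x ^√5 zero = one√5
x ^√5 suc n = x ⊗ (x ^√5 n)

three√5 : ℚ√5
three√5 = ℚ.0ℚ + ℕ→ℚ 3 √5

-- 2^{1-j} for j ∈ ℕ (possibly negative exponent), as 2·(1/2)^j
two^1-_ : ℕ → ℚ
two^1- j = ℕ→ℚ 2 ℚ.* (½ ^ℚ j)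

sum√5 : (n : ℕ) → (ℕ → ℚ√5) → ℚ√5
sum√5 zero f = f 0
sum√5 (suc n) f = sum√5 n f ⊕ f (suc n)

lhs : ℕ → ℚ√5
lhs n = sum√5 n (λ k →
  ι (ℕ→ℚ (n C k)) ⊗ (three√5 ^√5 (n ℕ.∸ k))
    ⊗ ι ((two^1- (n ℕ.∸ k)) ℚ.- ℚ.1ℚ)
    ⊗ ι (ℕ→ℚ (fib (4 ℕ.* k)))
    ⊗ ι (bernoulli (n ℕ.∸ k)))

-- right-hand side 3n(7/2)^{n-1}; for n = 0 this is 0 (the factor n kills
-- the negative power), so the truncated exponent n ∸ 1 is harmless.
rhs : ℕ → ℚ√5
rhs n = ι (ℕ→ℚ (3 ℕ.* n) ℚ.* ((+ 7 / 2) ^ℚ (n ℕ.∸ 1)))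

{-# OPTIONS --safe #-}
-- Read a sequence u as the exponential generating function Σ u n zⁿ/n!, so that
-- binomial convolution is the product of power series.  With B(z) = z/(eᶻ-1),
-- the factor (2^{1-j} - 1) Bⱼ is the coefficient sequence of
-- 2B(z/2) - B(z) = z/(e^{z/2} - e^{-z/2}), and the Fibonacci numbers F₄ₖ have
-- generating function (e^{αz} - e^{βz})/√5 = e^{7z/2}(e^{3√5z/2} - e^{-3√5z/2})/√5,
-- where α, β = (7 ± 3√5)/2 are the roots of t² = 7t - 1.  After the substitution
-- z ↦ 3√5z the two denominators cancel, and the left-hand side becomes the
-- coefficient sequence of e^{7z/2}·3√5z/√5 = 3z e^{7z/2}.
module Submission where

open import Defs
open import Data.Nat as ℕ using (ℕ; zero; suc; _∸_; _≤_; z≤n)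
import Data.Nat.Properties as ℕP
open import Data.Nat.Combinatorics
  using (_C_; nCk+nC[k+1]≡[n+1]C[k+1]; nCk≡nC[n∸k]; nCn≡1; nC1≡n; k>n⇒nCk≡0)
import Data.Nat.Tactic.RingSolver as ℕ-Solver
open import Data.Integer as ℤ using (+_)
import Data.Integer.Properties as ℤP
open import Data.Rational as ℚ using (ℚ; mkℚ; ½)
import Data.Rational.Properties as ℚP
open import Data.Nat.Coprimality using (1-coprimeTo) renaming (sym to coprime-sym)
open import Data.Fin using (Fin; toℕ)
open import Data.Vec using (_∷_; _∷ʳ_; lookup; tabulate; foldr)
import Data.Vec.Properties as Vecₚ
open import Data.Maybe using (Maybe; just; nothing)
open import Data.Product using (_×_; _,_; proj₁)
open import Function using (_∘_)
open import Algebra using (CommutativeRing)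
open import Algebra.Consequences.Propositional {A = ℚ√5}
  using (comm∧idˡ⇒id; comm∧invˡ⇒inv; comm∧distrˡ⇒distrʳ)
open import Relation.Binary.PropositionalEquality
open import Relation.Nullary using (yes)
open import Relation.Nullary.Decidable using (dec⇒maybe)
open import Tactic.RingSolver using (solve-∀)
open import Tactic.RingSolver.Core.AlmostCommutativeRing
  using (AlmostCommutativeRing; fromCommutativeRing)
open ≡-Reasoning

ℚ-ring : AlmostCommutativeRing _ _
ℚ-ring = fromCommutativeRing ℚP.+-*-commutativeRing (λ x → dec⇒maybe (ℚ.0ℚ ℚP.≟ x))

ℕ→ℚ≡mkℚ : ∀ n → ℕ→ℚ n ≡ mkℚ (+ n) 0 (coprime-sym (1-coprimeTo n))
ℕ→ℚ≡mkℚ n = ℚP.normalize-coprime (coprime-sym (1-coprimeTo n))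

ℕ→ℚ-+ : ∀ m n → ℕ→ℚ (m ℕ.+ n) ≡ ℕ→ℚ m ℚ.+ ℕ→ℚ n
ℕ→ℚ-+ m n rewrite ℕ→ℚ≡mkℚ m | ℕ→ℚ≡mkℚ n =
  cong (ℚ._/ 1) (sym (cong₂ ℤ._+_ (ℤP.*-identityʳ (+ m)) (ℤP.*-identityʳ (+ n))))

ℕ→ℚ-* : ∀ m n → ℕ→ℚ (m ℕ.* n) ≡ ℕ→ℚ m ℚ.* ℕ→ℚ n
ℕ→ℚ-* m n rewrite ℕ→ℚ≡mkℚ m | ℕ→ℚ≡mkℚ n = cong (ℚ._/ 1) (ℤP.pos-* m n)

ℕ→ℚ-*-inverseʳ : ∀ n → ℕ→ℚ (suc n) ℚ.* (+ 1 ℚ./ suc n) ≡ ℚ.1ℚ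
ℕ→ℚ-*-inverseʳ n = begin
  ℕ→ℚ (suc n) ℚ.* (+ 1 ℚ./ suc n)
    ≡⟨ cong₂ ℚ._*_ (ℕ→ℚ≡mkℚ (suc n)) (ℚP.normalize-coprime (1-coprimeTo (suc n))) ⟩
  p ℚ.* ℚ.1/ p ≡⟨ ℚP.*-inverseʳ p ⟩
  ℚ.1ℚ ∎
  where p = mkℚ (+ suc n) 0 (coprime-sym (1-coprimeTo (suc n)))

sumℚ-suc : ∀ n (f : ℕ → ℚ) → sumℚ (suc n) f ≡ f 0 ℚ.+ sumℚ n (f ∘ suc)
sumℚ-suc zero f = refl
sumℚ-suc (suc n) f = trans (cong (ℚ._+ f (suc (suc n))) (sumℚ-suc n f)) (ℚP.+-assoc (f 0) _ _)

neg√5 : ℚ√5 → ℚ√5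
neg√5 (a + b √5) = (ℚ.- a) + (ℚ.- b) √5

⊕-assoc : ∀ x y z → (x ⊕ y) ⊕ z ≡ x ⊕ (y ⊕ z)
⊕-assoc (a + b √5) (c + d √5) (e + f √5) = cong₂ _+_√5 (ℚP.+-assoc a c e) (ℚP.+-assoc b d f)

⊕-comm : ∀ x y → x ⊕ y ≡ y ⊕ x
⊕-comm (a + b √5) (c + d √5) = cong₂ _+_√5 (ℚP.+-comm a c) (ℚP.+-comm b d)

⊕-identityˡ : ∀ x → zero√5 ⊕ x ≡ x
⊕-identityˡ (a + b √5) = cong₂ _+_√5 (ℚP.+-identityˡ a) (ℚP.+-identityˡ b)

neg√5-inverseˡ : ∀ x → neg√5 x ⊕ x ≡ zero√5
neg√5-inverseˡ (a + b √5) = cong₂ _+_√5 (ℚP.+-inverseˡ a) (ℚP.+-inverseˡ b)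

⊗-assoc : ∀ x y z → (x ⊗ y) ⊗ z ≡ x ⊗ (y ⊗ z)
⊗-assoc (a + b √5) (c + d √5) (e + f √5) = cong₂ _+_√5 (re a b c d e f (ℕ→ℚ 5)) (im a b c d e f (ℕ→ℚ 5))
  where
  re : ∀ a b c d e f q →
       (a ℚ.* c ℚ.+ q ℚ.* (b ℚ.* d)) ℚ.* e ℚ.+ q ℚ.* ((a ℚ.* d ℚ.+ b ℚ.* c) ℚ.* f)
       ≡ a ℚ.* (c ℚ.* e ℚ.+ q ℚ.* (d ℚ.* f)) ℚ.+ q ℚ.* (b ℚ.* (c ℚ.* f ℚ.+ d ℚ.* e))
  re = solve-∀ ℚ-ring
  im : ∀ a b c d e f q →
       (a ℚ.* c ℚ.+ q ℚ.* (b ℚ.* d)) ℚ.* f ℚ.+ (a ℚ.* d ℚ.+ b ℚ.* c) ℚ.* e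
       ≡ a ℚ.* (c ℚ.* f ℚ.+ d ℚ.* e) ℚ.+ b ℚ.* (c ℚ.* e ℚ.+ q ℚ.* (d ℚ.* f))
  im = solve-∀ ℚ-ring

⊗-comm : ∀ x y → x ⊗ y ≡ y ⊗ x
⊗-comm (a + b √5) (c + d √5) =
  cong₂ _+_√5 (cong₂ ℚ._+_ (ℚP.*-comm a c) (cong (ℕ→ℚ 5 ℚ.*_) (ℚP.*-comm b d)))
              (trans (ℚP.+-comm (a ℚ.* d) (b ℚ.* c)) (cong₂ ℚ._+_ (ℚP.*-comm b c) (ℚP.*-comm a d)))

⊗-identityˡ : ∀ x → one√5 ⊗ x ≡ x
⊗-identityˡ (a + b √5) = cong₂ _+_√5 (re a b (ℕ→ℚ 5)) (im a b)
  where
  re : ∀ a b q → ℚ.1ℚ ℚ.* a ℚ.+ q ℚ.* (ℚ.0ℚ ℚ.* b) ≡ a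
  re = solve-∀ ℚ-ring
  im : ∀ a b → ℚ.1ℚ ℚ.* b ℚ.+ ℚ.0ℚ ℚ.* a ≡ b
  im = solve-∀ ℚ-ring

⊗-distribˡ-⊕ : ∀ x y z → x ⊗ (y ⊕ z) ≡ x ⊗ y ⊕ x ⊗ z
⊗-distribˡ-⊕ (a + b √5) (c + d √5) (e + f √5) = cong₂ _+_√5 (re a b c d e f (ℕ→ℚ 5)) (im a b c d e f)
  where
  re : ∀ a b c d e f q → a ℚ.* (c ℚ.+ e) ℚ.+ q ℚ.* (b ℚ.* (d ℚ.+ f))
       ≡ (a ℚ.* c ℚ.+ q ℚ.* (b ℚ.* d)) ℚ.+ (a ℚ.* e ℚ.+ q ℚ.* (b ℚ.* f))
  re = solve-∀ ℚ-ring
  im : ∀ a b c d e f → a ℚ.* (d ℚ.+ f) ℚ.+ b ℚ.* (c ℚ.+ e)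
       ≡ (a ℚ.* d ℚ.+ b ℚ.* c) ℚ.+ (a ℚ.* f ℚ.+ b ℚ.* e)
  im = solve-∀ ℚ-ring

ℚ√5-commutativeRing : CommutativeRing _ _
ℚ√5-commutativeRing = record
  { Carrier = ℚ√5 ; _≈_ = _≡_ ; _+_ = _⊕_ ; _*_ = _⊗_ ; -_ = neg√5 ; 0# = zero√5 ; 1# = one√5
  ; isCommutativeRing = record
    { isRing = record
      { +-isAbelianGroup = record
        { isGroup = record
          { isMonoid = record
            { isSemigroup = record
              { isMagma = record { isEquivalence = isEquivalence ; ∙-cong = cong₂ _⊕_ }
              ; assoc = ⊕-assoc }
            ; identity = comm∧idˡ⇒id ⊕-comm ⊕-identityˡ }
          ; inverse = comm∧invˡ⇒inv ⊕-comm neg√5-inverseˡ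
          ; ⁻¹-cong = cong neg√5 }
        ; comm = ⊕-comm }
      ; *-cong = cong₂ _⊗_
      ; *-assoc = ⊗-assoc
      ; *-identity = comm∧idˡ⇒id ⊗-comm ⊗-identityˡ
      ; distrib = ⊗-distribˡ-⊕ , comm∧distrˡ⇒distrʳ ⊗-comm ⊗-distribˡ-⊕ }
    ; *-comm = ⊗-comm } }

open CommutativeRing ℚ√5-commutativeRing using ()
  renaming (+-identityʳ to ⊕-identityʳ; -‿inverseʳ to neg√5-inverseʳ; *-identityʳ to ⊗-identityʳ;
            distribʳ to ⊗-distribʳ-⊕; zeroˡ to ⊗-zeroˡ)

ℚ√5-ring : AlmostCommutativeRing _ _
ℚ√5-ring = fromCommutativeRing ℚ√5-commutativeRing isZero
  where
  isZero : ∀ x → Maybe (zero√5 ≡ x)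
  isZero (a + b √5) with ℚ.0ℚ ℚP.≟ a | ℚ.0ℚ ℚP.≟ b
  ... | yes refl | yes refl = just refl
  ... | _        | _        = nothing

ι-* : ∀ a b → ι (a ℚ.* b) ≡ ι a ⊗ ι b
ι-* a b = cong₂ _+_√5 (re a b (ℕ→ℚ 5)) (im a b)
  where
  re : ∀ a b q → a ℚ.* b ≡ a ℚ.* b ℚ.+ q ℚ.* (ℚ.0ℚ ℚ.* ℚ.0ℚ)
  re = solve-∀ ℚ-ring
  im : ∀ a b → ℚ.0ℚ ≡ a ℚ.* ℚ.0ℚ ℚ.+ ℚ.0ℚ ℚ.* b
  im = solve-∀ ℚ-ring

ι-^ : ∀ a j → ι (a ^ℚ j) ≡ ι a ^√5 j
ι-^ a zero = refl
ι-^ a (suc j) = trans (ι-* a (a ^ℚ j)) (cong (ι a ⊗_) (ι-^ a j))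

ι-sum : ∀ n (f : ℕ → ℚ) → ι (sumℚ n f) ≡ sum√5 n (ι ∘ f)
ι-sum zero f = refl
ι-sum (suc n) f = cong (_⊕ ι (f (suc n))) (ι-sum n f)

ιℕ : ℕ → ℚ√5
ιℕ n = ι (ℕ→ℚ n)

^√5-distrib-⊗ : ∀ a b n → (a ⊗ b) ^√5 n ≡ a ^√5 n ⊗ b ^√5 n
^√5-distrib-⊗ a b zero = refl
^√5-distrib-⊗ a b (suc n) = trans (cong ((a ⊗ b) ⊗_) (^√5-distrib-⊗ a b n)) (swap a b (a ^√5 n) (b ^√5 n))
  where
  swap : ∀ a b x y → a ⊗ b ⊗ (x ⊗ y) ≡ a ⊗ x ⊗ (b ⊗ y)
  swap = solve-∀ ℚ√5-ring

sum√5-cong : ∀ n {f g : ℕ → ℚ√5} → (∀ k → k ≤ n → f k ≡ g k) → sum√5 n f ≡ sum√5 n g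
sum√5-cong zero f≗g = f≗g 0 z≤n
sum√5-cong (suc n) f≗g =
  cong₂ _⊕_ (sum√5-cong n (λ k k≤n → f≗g k (ℕP.m≤n⇒m≤1+n k≤n))) (f≗g (suc n) ℕP.≤-refl)

sum√5-⊕ : ∀ n (f g : ℕ → ℚ√5) → sum√5 n (λ k → f k ⊕ g k) ≡ sum√5 n f ⊕ sum√5 n g
sum√5-⊕ zero f g = refl
sum√5-⊕ (suc n) f g =
  trans (cong (_⊕ (f (suc n) ⊕ g (suc n))) (sum√5-⊕ n f g))
        (interchange (sum√5 n f) (sum√5 n g) (f (suc n)) (g (suc n)))
  where
  interchange : ∀ a b c d → (a ⊕ b) ⊕ (c ⊕ d) ≡ (a ⊕ c) ⊕ (b ⊕ d)
  interchange = solve-∀ ℚ√5-ring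

sum√5-⊗ˡ : ∀ n c (f : ℕ → ℚ√5) → sum√5 n (λ k → c ⊗ f k) ≡ c ⊗ sum√5 n f
sum√5-⊗ˡ zero c f = refl
sum√5-⊗ˡ (suc n) c f =
  trans (cong (_⊕ c ⊗ f (suc n)) (sum√5-⊗ˡ n c f)) (sym (⊗-distribˡ-⊕ c (sum√5 n f) (f (suc n))))

sum√5-zero : ∀ n → sum√5 n (λ _ → zero√5) ≡ zero√5
sum√5-zero zero = refl
sum√5-zero (suc n) = trans (cong (_⊕ zero√5) (sum√5-zero n)) (⊕-identityˡ zero√5)

sum√5-suc : ∀ n (f : ℕ → ℚ√5) → sum√5 (suc n) f ≡ f 0 ⊕ sum√5 n (f ∘ suc)
sum√5-suc zero f = refl
sum√5-suc (suc n) f = trans (cong (_⊕ f (suc (suc n))) (sum√5-suc n f)) (⊕-assoc (f 0) _ _)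

-- Sequences and binomial convolution

Seq : Set
Seq = ℕ → ℚ√5

infix 4 _≋_
_≋_ : Seq → Seq → Set
u ≋ v = ∀ n → u n ≡ v n

infixl 6 _⊞_
_⊞_ : Seq → Seq → Seq
(u ⊞ v) n = u n ⊕ v n

infixr 8 _·_
_·_ : ℚ√5 → Seq → Seq
(c · u) n = c ⊗ u n

shift : Seq → Seq
shift u n = u (suc n)

binom : ℕ → ℕ → ℚ√5
binom n k = ιℕ (n C k)

infixl 7 _⋆_
_⋆_ : Seq → Seq → Seq
(u ⋆ v) n = sum√5 n (λ k → binom n k ⊗ u k ⊗ v (n ∸ k))

binom-zero : ∀ n → binom n 0 ≡ one√5
binom-zero n = cong ιℕ (trans (nCk≡nC[n∸k] {0} {n} z≤n) (nCn≡1 n))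

binom-pascal : ∀ n k → binom (suc n) (suc k) ≡ binom n k ⊕ binom n (suc k)
binom-pascal n k = trans (cong ιℕ (sym (nCk+nC[k+1]≡[n+1]C[k+1] n k))) (cong ι (ℕ→ℚ-+ (n C k) (n C suc k)))

binom-suc-self : ∀ n → binom n (suc n) ≡ zero√5
binom-suc-self n = cong ιℕ (k>n⇒nCk≡0 (ℕP.≤-refl {suc n}))

-- Pascal's rule makes shift a derivation of ⋆.
shift-⋆ : ∀ u v → shift (u ⋆ v) ≋ shift u ⋆ v ⊞ u ⋆ shift v
shift-⋆ u v n = begin
  (u ⋆ v) (suc n)
    ≡⟨ sum√5-suc n _ ⟩
  binom (suc n) 0 ⊗ u 0 ⊗ v (suc n) ⊕ sum√5 n (λ k → binom (suc n) (suc k) ⊗ u (suc k) ⊗ v (n ∸ k))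
    ≡⟨ cong₂ _⊕_ (cong (λ b → b ⊗ u 0 ⊗ v (suc n)) (trans (binom-zero (suc n)) (sym (binom-zero n))))
                 (trans (sum√5-cong n (λ k _ → pascal k)) (sum√5-⊕ n _ _)) ⟩
  T 0 ⊕ ((shift u ⋆ v) n ⊕ sum√5 n (T ∘ suc))
    ≡⟨ rotate (T 0) ((shift u ⋆ v) n) (sum√5 n (T ∘ suc)) ⟩
  (shift u ⋆ v) n ⊕ (T 0 ⊕ sum√5 n (T ∘ suc))
    ≡⟨ cong ((shift u ⋆ v) n ⊕_) (trans (sym (sum√5-suc n T)) (cong (sum√5 n T ⊕_) last-vanishes)) ⟩
  (shift u ⋆ v) n ⊕ (sum√5 n T ⊕ zero√5)
    ≡⟨ cong ((shift u ⋆ v) n ⊕_) (trans (⊕-identityʳ (sum√5 n T)) (sum√5-cong n (λ k k≤n →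
         cong (λ m → binom n k ⊗ u k ⊗ v m) (ℕP.+-∸-assoc 1 k≤n)))) ⟩
  (shift u ⋆ v) n ⊕ (u ⋆ shift v) n ∎
  where
  T : ℕ → ℚ√5
  T k = binom n k ⊗ u k ⊗ v (suc n ∸ k)
  split : ∀ a b x y → (a ⊕ b) ⊗ x ⊗ y ≡ a ⊗ x ⊗ y ⊕ b ⊗ x ⊗ y
  split = solve-∀ ℚ√5-ring
  pascal : ∀ k → binom (suc n) (suc k) ⊗ u (suc k) ⊗ v (n ∸ k)
               ≡ binom n k ⊗ u (suc k) ⊗ v (n ∸ k) ⊕ T (suc k)
  pascal k = trans (cong (λ b → b ⊗ u (suc k) ⊗ v (n ∸ k)) (binom-pascal n k))
                   (split (binom n k) (binom n (suc k)) (u (suc k)) (v (n ∸ k)))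
  rotate : ∀ a b c → a ⊕ (b ⊕ c) ≡ b ⊕ (a ⊕ c)
  rotate = solve-∀ ℚ√5-ring
  vanish : ∀ x y → zero√5 ⊗ x ⊗ y ≡ zero√5
  vanish = solve-∀ ℚ√5-ring
  last-vanishes : T (suc n) ≡ zero√5
  last-vanishes = trans (cong (λ b → b ⊗ u (suc n) ⊗ v (n ∸ n)) (binom-suc-self n)) (vanish (u (suc n)) (v (n ∸ n)))

⋆-congˡ : ∀ {u u′} v → u ≋ u′ → u ⋆ v ≋ u′ ⋆ v
⋆-congˡ v u≋u′ n = sum√5-cong n (λ k _ → cong (λ x → binom n k ⊗ x ⊗ v (n ∸ k)) (u≋u′ k))

⋆-congʳ : ∀ u {v v′} → v ≋ v′ → u ⋆ v ≋ u ⋆ v′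
⋆-congʳ u v≋v′ n = sum√5-cong n (λ k _ → cong (λ x → binom n k ⊗ u k ⊗ x) (v≋v′ (n ∸ k)))

⋆-distribʳ-⊞ : ∀ u u′ v → (u ⊞ u′) ⋆ v ≋ u ⋆ v ⊞ u′ ⋆ v
⋆-distribʳ-⊞ u u′ v n = trans (sum√5-cong n (λ k _ → split (binom n k) (u k) (u′ k) (v (n ∸ k)))) (sum√5-⊕ n _ _)
  where
  split : ∀ b x y z → b ⊗ (x ⊕ y) ⊗ z ≡ b ⊗ x ⊗ z ⊕ b ⊗ y ⊗ z
  split = solve-∀ ℚ√5-ring

⋆-·ˡ : ∀ c u v → (c · u) ⋆ v ≋ c · (u ⋆ v)
⋆-·ˡ c u v n = trans (sum√5-cong n (λ k _ → pull (binom n k) c (u k) (v (n ∸ k)))) (sum√5-⊗ˡ n c _)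
  where
  pull : ∀ b c x z → b ⊗ (c ⊗ x) ⊗ z ≡ c ⊗ (b ⊗ x ⊗ z)
  pull = solve-∀ ℚ√5-ring

⋆-comm : ∀ u v → u ⋆ v ≋ v ⋆ u
⋆-comm u v zero = swap (binom 0 0) (u 0) (v 0)
  where
  swap : ∀ b x y → b ⊗ x ⊗ y ≡ b ⊗ y ⊗ x
  swap = solve-∀ ℚ√5-ring
⋆-comm u v (suc n) = begin
  (u ⋆ v) (suc n)                       ≡⟨ shift-⋆ u v n ⟩
  (shift u ⋆ v) n ⊕ (u ⋆ shift v) n     ≡⟨ cong₂ _⊕_ (⋆-comm (shift u) v n) (⋆-comm u (shift v) n) ⟩
  (v ⋆ shift u) n ⊕ (shift v ⋆ u) n     ≡⟨ ⊕-comm ((v ⋆ shift u) n) ((shift v ⋆ u) n) ⟩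
  (shift v ⋆ u) n ⊕ (v ⋆ shift u) n     ≡⟨ sym (shift-⋆ v u n) ⟩
  (v ⋆ u) (suc n)                       ∎

⋆-distribˡ-⊞ : ∀ u v v′ → u ⋆ (v ⊞ v′) ≋ u ⋆ v ⊞ u ⋆ v′
⋆-distribˡ-⊞ u v v′ n =
  trans (⋆-comm u (v ⊞ v′) n)
        (trans (⋆-distribʳ-⊞ v v′ u n) (cong₂ _⊕_ (⋆-comm v u n) (⋆-comm v′ u n)))

⋆-·ʳ : ∀ c u v → u ⋆ (c · v) ≋ c · (u ⋆ v)
⋆-·ʳ c u v n = trans (⋆-comm u (c · v) n) (trans (⋆-·ˡ c v u n) (cong (c ⊗_) (⋆-comm v u n)))

⋆-assoc : ∀ u v w → (u ⋆ v) ⋆ w ≋ u ⋆ (v ⋆ w)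
⋆-assoc u v w zero = regroup (binom 0 0) (u 0) (v 0) (w 0)
  where
  regroup : ∀ b x y z → b ⊗ (b ⊗ x ⊗ y) ⊗ z ≡ b ⊗ x ⊗ (b ⊗ y ⊗ z)
  regroup = solve-∀ ℚ√5-ring
⋆-assoc u v w (suc n) = begin
  ((u ⋆ v) ⋆ w) (suc n)
    ≡⟨ shift-⋆ (u ⋆ v) w n ⟩
  (shift (u ⋆ v) ⋆ w) n ⊕ ((u ⋆ v) ⋆ shift w) n
    ≡⟨ cong (_⊕ ((u ⋆ v) ⋆ shift w) n)
         (trans (⋆-congˡ w (shift-⋆ u v) n) (⋆-distribʳ-⊞ (shift u ⋆ v) (u ⋆ shift v) w n)) ⟩
  ((shift u ⋆ v) ⋆ w) n ⊕ ((u ⋆ shift v) ⋆ w) n ⊕ ((u ⋆ v) ⋆ shift w) n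
    ≡⟨ cong₂ _⊕_ (cong₂ _⊕_ (⋆-assoc (shift u) v w n) (⋆-assoc u (shift v) w n)) (⋆-assoc u v (shift w) n) ⟩
  (shift u ⋆ (v ⋆ w)) n ⊕ (u ⋆ (shift v ⋆ w)) n ⊕ (u ⋆ (v ⋆ shift w)) n
    ≡⟨ ⊕-assoc ((shift u ⋆ (v ⋆ w)) n) ((u ⋆ (shift v ⋆ w)) n) ((u ⋆ (v ⋆ shift w)) n) ⟩
  (shift u ⋆ (v ⋆ w)) n ⊕ ((u ⋆ (shift v ⋆ w)) n ⊕ (u ⋆ (v ⋆ shift w)) n)
    ≡⟨ cong ((shift u ⋆ (v ⋆ w)) n ⊕_)
         (sym (trans (⋆-congʳ u (shift-⋆ v w) n) (⋆-distribˡ-⊞ u (shift v ⋆ w) (v ⋆ shift w) n))) ⟩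
  (shift u ⋆ (v ⋆ w)) n ⊕ (u ⋆ shift (v ⋆ w)) n
    ≡⟨ sym (shift-⋆ u (v ⋆ w) n) ⟩
  (u ⋆ (v ⋆ w)) (suc n) ∎

δ₀ : Seq
δ₀ zero = one√5
δ₀ (suc _) = zero√5

var : Seq
var 1 = one√5
var _ = zero√5

exp : ℚ√5 → Seq
exp t n = t ^√5 n

⋆-zeroʳ : ∀ u → u ⋆ (λ _ → zero√5) ≋ (λ _ → zero√5)
⋆-zeroʳ u n = trans (sum√5-cong n (λ k _ → vanish (binom n k) (u k))) (sum√5-zero n)
  where
  vanish : ∀ b x → b ⊗ x ⊗ zero√5 ≡ zero√5
  vanish = solve-∀ ℚ√5-ring

⋆-identityʳ : ∀ u → u ⋆ δ₀ ≋ u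
⋆-identityʳ u zero = trans (cong (λ b → b ⊗ u 0 ⊗ one√5) (binom-zero 0)) (unit (u 0))
  where
  unit : ∀ x → one√5 ⊗ x ⊗ one√5 ≡ x
  unit = solve-∀ ℚ√5-ring
⋆-identityʳ u (suc n) = begin
  (u ⋆ δ₀) (suc n)                       ≡⟨ shift-⋆ u δ₀ n ⟩
  (shift u ⋆ δ₀) n ⊕ (u ⋆ shift δ₀) n    ≡⟨ cong₂ _⊕_ (⋆-identityʳ (shift u) n) (⋆-zeroʳ u n) ⟩
  u (suc n) ⊕ zero√5                     ≡⟨ ⊕-identityʳ (u (suc n)) ⟩
  u (suc n)                              ∎

exp-zero : exp zero√5 ≋ δ₀
exp-zero zero = refl
exp-zero (suc n) = ⊗-zeroˡ (exp zero√5 n)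

exp-⋆-exp : ∀ s t → exp s ⋆ exp t ≋ exp (s ⊕ t)
exp-⋆-exp s t zero = refl
exp-⋆-exp s t (suc n) = begin
  (exp s ⋆ exp t) (suc n)                        ≡⟨ shift-⋆ (exp s) (exp t) n ⟩
  (s · exp s ⋆ exp t) n ⊕ (exp s ⋆ t · exp t) n
    ≡⟨ cong₂ _⊕_ (⋆-·ˡ s (exp s) (exp t) n) (⋆-·ʳ t (exp s) (exp t) n) ⟩
  s ⊗ (exp s ⋆ exp t) n ⊕ t ⊗ (exp s ⋆ exp t) n  ≡⟨ sym (⊗-distribʳ-⊕ ((exp s ⋆ exp t) n) s t) ⟩
  (s ⊕ t) ⊗ (exp s ⋆ exp t) n                    ≡⟨ cong ((s ⊕ t) ⊗_) (exp-⋆-exp s t n) ⟩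
  exp (s ⊕ t) (suc n)                            ∎

exp-⋆-exp-neg : ∀ t → exp t ⋆ exp (neg√5 t) ≋ δ₀
exp-⋆-exp-neg t n =
  trans (exp-⋆-exp t (neg√5 t) n) (trans (cong (λ s → exp s n) (neg√5-inverseʳ t)) (exp-zero n))

⋆-exp-cancelʳ : ∀ u t → (u ⋆ exp t) ⋆ exp (neg√5 t) ≋ u
⋆-exp-cancelʳ u t n = begin
  ((u ⋆ exp t) ⋆ exp (neg√5 t)) n  ≡⟨ ⋆-assoc u (exp t) (exp (neg√5 t)) n ⟩
  (u ⋆ (exp t ⋆ exp (neg√5 t))) n  ≡⟨ ⋆-congʳ u (exp-⋆-exp-neg t) n ⟩
  (u ⋆ δ₀) n                       ≡⟨ ⋆-identityʳ u n ⟩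
  u n                              ∎

exp-⋆-var : ∀ t → exp t ⋆ var ≋ λ n → ιℕ n ⊗ t ^√5 (n ∸ 1)
exp-⋆-var t zero = vanish (binom 0 0)
  where
  vanish : ∀ b → b ⊗ one√5 ⊗ zero√5 ≡ zero√5 ⊗ one√5
  vanish = solve-∀ ℚ√5-ring
exp-⋆-var t (suc n) = begin
  (exp t ⋆ var) (suc n)                       ≡⟨ shift-⋆ (exp t) var n ⟩
  (t · exp t ⋆ var) n ⊕ (exp t ⋆ shift var) n ≡⟨ cong₂ _⊕_ (⋆-·ˡ t (exp t) var n)
                                                   (trans (⋆-congʳ (exp t) shift-var n) (⋆-identityʳ (exp t) n)) ⟩
  t ⊗ (exp t ⋆ var) n ⊕ t ^√5 n              ≡⟨ cong (λ x → t ⊗ x ⊕ t ^√5 n) (exp-⋆-var t n) ⟩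
  t ⊗ (ιℕ n ⊗ t ^√5 (n ∸ 1)) ⊕ t ^√5 n       ≡⟨ step n ⟩
  ιℕ (suc n) ⊗ t ^√5 n                       ∎
  where
  shift-var : shift var ≋ δ₀
  shift-var zero = refl
  shift-var (suc n) = refl
  step : ∀ n → t ⊗ (ιℕ n ⊗ t ^√5 (n ∸ 1)) ⊕ t ^√5 n ≡ ιℕ (suc n) ⊗ t ^√5 n
  step zero = base t
    where
    base : ∀ t → t ⊗ (zero√5 ⊗ one√5) ⊕ one√5 ≡ one√5 ⊗ one√5
    base = solve-∀ ℚ√5-ring
  step (suc m) = trans (collect t (ιℕ (suc m)) (t ^√5 m)) (cong (λ c → ι c ⊗ t ^√5 suc m) (sym (ℕ→ℚ-+ 1 (suc m))))
    where
    collect : ∀ t a p → t ⊗ (a ⊗ p) ⊕ t ⊗ p ≡ (one√5 ⊕ a) ⊗ (t ⊗ p)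
    collect = solve-∀ ℚ√5-ring

-- Dilation z ↦ cz of generating functions.
dilate : ℚ√5 → Seq → Seq
dilate c u n = c ^√5 n ⊗ u n

dilate-⋆ : ∀ c u v → dilate c u ⋆ dilate c v ≋ dilate c (u ⋆ v)
dilate-⋆ c u v zero = regroup (binom 0 0) (u 0) (v 0)
  where
  regroup : ∀ b x y → b ⊗ (one√5 ⊗ x) ⊗ (one√5 ⊗ y) ≡ one√5 ⊗ (b ⊗ x ⊗ y)
  regroup = solve-∀ ℚ√5-ring
dilate-⋆ c u v (suc n) = begin
  (dilate c u ⋆ dilate c v) (suc n)
    ≡⟨ shift-⋆ (dilate c u) (dilate c v) n ⟩
  (shift (dilate c u) ⋆ dilate c v) n ⊕ (dilate c u ⋆ shift (dilate c v)) n
    ≡⟨ cong₂ _⊕_ (trans (⋆-congˡ (dilate c v) (shift-dilate u) n) (⋆-·ˡ c (dilate c (shift u)) (dilate c v) n))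
                 (trans (⋆-congʳ (dilate c u) (shift-dilate v) n) (⋆-·ʳ c (dilate c u) (dilate c (shift v)) n)) ⟩
  c ⊗ (dilate c (shift u) ⋆ dilate c v) n ⊕ c ⊗ (dilate c u ⋆ dilate c (shift v)) n
    ≡⟨ cong₂ (λ a b → c ⊗ a ⊕ c ⊗ b) (dilate-⋆ c (shift u) v n) (dilate-⋆ c u (shift v) n) ⟩
  c ⊗ (c ^√5 n ⊗ (shift u ⋆ v) n) ⊕ c ⊗ (c ^√5 n ⊗ (u ⋆ shift v) n)
    ≡⟨ factor c (c ^√5 n) ((shift u ⋆ v) n) ((u ⋆ shift v) n) ⟩
  c ⊗ c ^√5 n ⊗ ((shift u ⋆ v) n ⊕ (u ⋆ shift v) n)
    ≡⟨ cong (c ⊗ c ^√5 n ⊗_) (sym (shift-⋆ u v n)) ⟩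
  dilate c (u ⋆ v) (suc n) ∎
  where
  shift-dilate : ∀ w → shift (dilate c w) ≋ c · dilate c (shift w)
  shift-dilate w k = ⊗-assoc c (c ^√5 k) (w (suc k))
  factor : ∀ c p x y → c ⊗ (p ⊗ x) ⊕ c ⊗ (p ⊗ y) ≡ c ⊗ p ⊗ (x ⊕ y)
  factor = solve-∀ ℚ√5-ring

dilate-exp : ∀ c t → dilate c (exp t) ≋ exp (c ⊗ t)
dilate-exp c t n = sym (^√5-distrib-⊗ c t n)

dilate-var : ∀ c → dilate c var ≋ c · var
dilate-var c zero = trans (⊗-identityˡ zero√5) (sym (annihilate c))
  where
  annihilate : ∀ c → c ⊗ zero√5 ≡ zero√5
  annihilate = solve-∀ ℚ√5-ring
dilate-var c (suc zero) = cong (_⊗ one√5) (⊗-identityʳ c)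
dilate-var c (suc (suc n)) = annihilate c (c ^√5 suc (suc n))
  where
  annihilate : ∀ c p → p ⊗ zero√5 ≡ c ⊗ zero√5
  annihilate = solve-∀ ℚ√5-ring

-- Bernoulli numbers

tabulate-∷ʳ : ∀ {A : Set} n (f : ℕ → A) → tabulate {n = n} (f ∘ toℕ) ∷ʳ f n ≡ tabulate (f ∘ toℕ)
tabulate-∷ʳ zero f = refl
tabulate-∷ʳ (suc n) f = cong (f 0 ∷_) (tabulate-∷ʳ n (f ∘ suc))

bernVec≡tabulate : ∀ m → bernVec m ≡ tabulate (bernoulli ∘ toℕ)
bernVec≡tabulate zero = refl
bernVec≡tabulate (suc m) = begin
  bernVec m ∷ʳ next
    ≡⟨ cong₂ _∷ʳ_ (bernVec≡tabulate m) (sym (Vecₚ.last-∷ʳ next (bernVec m))) ⟩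
  tabulate (bernoulli ∘ toℕ) ∷ʳ bernoulli (suc m)   ≡⟨ tabulate-∷ʳ (suc m) bernoulli ⟩
  tabulate (bernoulli ∘ toℕ)                        ∎
  where next = bernNext (suc m) (bernVec m)

foldr-+-tabulate : ∀ m (g : ℕ → ℚ) →
                   foldr (λ _ → ℚ) ℚ._+_ ℚ.0ℚ (tabulate {n = suc m} (g ∘ toℕ)) ≡ sumℚ m g
foldr-+-tabulate zero g = ℚP.+-identityʳ (g 0)
foldr-+-tabulate (suc m) g = trans (cong (g 0 ℚ.+_) (foldr-+-tabulate m (g ∘ suc))) (sym (sumℚ-suc m g))

bernoulli-suc : ∀ m → bernoulli (suc m)
                ≡ ℚ.- ((+ 1 ℚ./ suc (suc m)) ℚ.* sumℚ m (λ k → ℕ→ℚ (suc (suc m) C k) ℚ.* bernoulli k))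
bernoulli-suc m = begin
  bernoulli (suc m)                              ≡⟨ Vecₚ.last-∷ʳ (bernNext (suc m) (bernVec m)) (bernVec m) ⟩
  bernNext (suc m) (bernVec m)                   ≡⟨ cong (bernNext (suc m)) (bernVec≡tabulate m) ⟩
  bernNext (suc m) (tabulate (bernoulli ∘ toℕ))  ≡⟨ cong (λ s → ℚ.- ((+ 1 ℚ./ suc (suc m)) ℚ.* s)) sum≡ ⟩
  ℚ.- ((+ 1 ℚ./ suc (suc m)) ℚ.* sumℚ m g)      ∎
  where
  g : ℕ → ℚ
  g k = ℕ→ℚ (suc (suc m) C k) ℚ.* bernoulli k
  sum≡ : foldr (λ _ → ℚ) ℚ._+_ ℚ.0ℚ
           (tabulate (λ (i : Fin (suc m)) → ℕ→ℚ (suc (suc m) C toℕ i) ℚ.* lookup (tabulate (bernoulli ∘ toℕ)) i))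
         ≡ sumℚ m g
  sum≡ = trans (cong (foldr (λ _ → ℚ) ℚ._+_ ℚ.0ℚ)
                 (Vecₚ.tabulate-cong (λ (i : Fin (suc m)) → cong (ℕ→ℚ (suc (suc m) C toℕ i) ℚ.*_)
                                                  (Vecₚ.lookup∘tabulate (bernoulli ∘ toℕ) i))))
               (foldr-+-tabulate m g)

bernoulli-recurrence : ∀ m → sumℚ (suc m) (λ k → ℕ→ℚ (suc (suc m) C k) ℚ.* bernoulli k) ≡ ℚ.0ℚ
bernoulli-recurrence m = begin
  S ℚ.+ ℕ→ℚ (suc (suc m) C suc m) ℚ.* bernoulli (suc m)
    ≡⟨ cong₂ (λ c b → S ℚ.+ ℕ→ℚ c ℚ.* b) top (bernoulli-suc m) ⟩
  S ℚ.+ p ℚ.* (ℚ.- (r ℚ.* S))  ≡⟨ cancel S p r ⟩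
  S ℚ.- (p ℚ.* r) ℚ.* S        ≡⟨ cong (λ c → S ℚ.- c ℚ.* S) (ℕ→ℚ-*-inverseʳ (suc m)) ⟩
  S ℚ.- ℚ.1ℚ ℚ.* S             ≡⟨ vanish S ⟩
  ℚ.0ℚ                         ∎
  where
  S = sumℚ m (λ k → ℕ→ℚ (suc (suc m) C k) ℚ.* bernoulli k)
  p = ℕ→ℚ (suc (suc m))
  r = + 1 ℚ./ suc (suc m)
  top : suc (suc m) C suc m ≡ suc (suc m)
  top = trans (nCk≡nC[n∸k] {suc m} {suc (suc m)} (ℕP.n≤1+n (suc m)))
              (trans (cong (suc (suc m) C_) (ℕP.m+n∸n≡m 1 (suc m))) (nC1≡n (suc (suc m))))
  cancel : ∀ S p r → S ℚ.+ p ℚ.* (ℚ.- (r ℚ.* S)) ≡ S ℚ.- (p ℚ.* r) ℚ.* S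
  cancel = solve-∀ ℚ-ring
  vanish : ∀ S → S ℚ.- ℚ.1ℚ ℚ.* S ≡ ℚ.0ℚ
  vanish = solve-∀ ℚ-ring

bern : Seq
bern k = ι (bernoulli k)

bern-⋆-exp-one : bern ⋆ exp one√5 ≋ bern ⊞ var
bern-⋆-exp-one zero = refl
bern-⋆-exp-one (suc zero) = refl
bern-⋆-exp-one (suc (suc m)) = begin
  (bern ⋆ exp one√5) (suc (suc m))
    ≡⟨ binomial-sum (suc (suc m)) ⟩
  ι (sumℚ (suc m) g ℚ.+ ℕ→ℚ (suc (suc m) C suc (suc m)) ℚ.* bernoulli (suc (suc m)))
    ≡⟨ cong ι (cong₂ (λ s c → s ℚ.+ ℕ→ℚ c ℚ.* bernoulli (suc (suc m)))
                     (bernoulli-recurrence m) (nCn≡1 (suc (suc m)))) ⟩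
  ι (ℚ.0ℚ ℚ.+ ℚ.1ℚ ℚ.* bernoulli (suc (suc m)))
    ≡⟨ cong ι (simplify (bernoulli (suc (suc m)))) ⟩
  bern (suc (suc m)) ⊕ zero√5 ∎
  where
  g : ℕ → ℚ
  g k = ℕ→ℚ (suc (suc m) C k) ℚ.* bernoulli k
  one-^ : ∀ j → one√5 ^√5 j ≡ one√5
  one-^ zero = refl
  one-^ (suc j) = cong (one√5 ⊗_) (one-^ j)
  binomial-sum : ∀ n → (bern ⋆ exp one√5) n ≡ ι (sumℚ n (λ k → ℕ→ℚ (n C k) ℚ.* bernoulli k))
  binomial-sum n = trans (sum√5-cong n (λ k _ → trans (cong (binom n k ⊗ bern k ⊗_) (one-^ (n ∸ k)))
                                                 (trans (⊗-identityʳ (binom n k ⊗ bern k))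
                                                        (sym (ι-* (ℕ→ℚ (n C k)) (bernoulli k))))))
                         (sym (ι-sum n _))
  simplify : ∀ b → ℚ.0ℚ ℚ.+ ℚ.1ℚ ℚ.* b ≡ b ℚ.+ ℚ.0ℚ
  simplify = solve-∀ ℚ-ring

-- 2B(z/2) - B(z) = z/(e^{z/2} - e^{-z/2})

half two minusOne : ℚ√5
half = ι ½
two = ιℕ 2
minusOne = neg√5 one√5

bernHalf bernDiff twoSinhHalf : Seq
bernHalf = dilate half bern
bernDiff = two · bernHalf ⊞ minusOne · bern
twoSinhHalf = exp half ⊞ minusOne · exp (neg√5 half)

bernHalf-⋆-exp-half : bernHalf ⋆ exp half ≋ bernHalf ⊞ half · var
bernHalf-⋆-exp-half n = begin
  (bernHalf ⋆ exp half) n                      ≡⟨ ⋆-congʳ bernHalf exp-half n ⟩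
  (bernHalf ⋆ dilate half (exp one√5)) n       ≡⟨ dilate-⋆ half bern (exp one√5) n ⟩
  half ^√5 n ⊗ (bern ⋆ exp one√5) n            ≡⟨ cong (half ^√5 n ⊗_) (bern-⋆-exp-one n) ⟩
  half ^√5 n ⊗ (bern n ⊕ var n)                ≡⟨ ⊗-distribˡ-⊕ (half ^√5 n) (bern n) (var n) ⟩
  bernHalf n ⊕ half ^√5 n ⊗ var n              ≡⟨ cong (bernHalf n ⊕_) (dilate-var half n) ⟩
  bernHalf n ⊕ half ⊗ var n                    ∎
  where
  exp-half : exp half ≋ dilate half (exp one√5)
  exp-half n = sym (dilate-exp half one√5 n)

bernHalf-⋆-exp-one : bernHalf ⋆ exp one√5 ≋ bernHalf ⊞ half · var ⊞ half · (var ⋆ exp half)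
bernHalf-⋆-exp-one n = begin
  (bernHalf ⋆ exp one√5) n                     ≡⟨ ⋆-congʳ bernHalf (λ k → sym (exp-⋆-exp half half k)) n ⟩
  (bernHalf ⋆ (exp half ⋆ exp half)) n         ≡⟨ sym (⋆-assoc bernHalf (exp half) (exp half) n) ⟩
  (bernHalf ⋆ exp half ⋆ exp half) n           ≡⟨ ⋆-congˡ (exp half) bernHalf-⋆-exp-half n ⟩
  ((bernHalf ⊞ half · var) ⋆ exp half) n       ≡⟨ ⋆-distribʳ-⊞ bernHalf (half · var) (exp half) n ⟩
  (bernHalf ⋆ exp half) n ⊕ (half · var ⋆ exp half) n
    ≡⟨ cong₂ _⊕_ (bernHalf-⋆-exp-half n) (⋆-·ˡ half var (exp half) n) ⟩
  bernHalf n ⊕ half ⊗ var n ⊕ half ⊗ (var ⋆ exp half) n ∎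

bernDiff-⋆-exp-one : bernDiff ⋆ exp one√5 ≋ bernDiff ⊞ var ⋆ exp half
bernDiff-⋆-exp-one n = begin
  (bernDiff ⋆ exp one√5) n
    ≡⟨ ⋆-distribʳ-⊞ (two · bernHalf) (minusOne · bern) (exp one√5) n ⟩
  (two · bernHalf ⋆ exp one√5) n ⊕ (minusOne · bern ⋆ exp one√5) n
    ≡⟨ cong₂ _⊕_ (⋆-·ˡ two bernHalf (exp one√5) n) (⋆-·ˡ minusOne bern (exp one√5) n) ⟩
  two ⊗ (bernHalf ⋆ exp one√5) n ⊕ minusOne ⊗ (bern ⋆ exp one√5) n
    ≡⟨ cong₂ (λ a b → two ⊗ a ⊕ minusOne ⊗ b) (bernHalf-⋆-exp-one n) (bern-⋆-exp-one n) ⟩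
  two ⊗ (bernHalf n ⊕ half ⊗ var n ⊕ half ⊗ Q) ⊕ minusOne ⊗ (bern n ⊕ var n)
    ≡⟨ rearrange two half (bernHalf n) (bern n) (var n) Q ⟩
  bernDiff n ⊕ Q ⊕ (two ⊗ half ⊕ minusOne) ⊗ (var n ⊕ Q)
    ≡⟨ cong (λ c → bernDiff n ⊕ Q ⊕ c ⊗ (var n ⊕ Q)) two-half ⟩
  bernDiff n ⊕ Q ⊕ zero√5 ⊗ (var n ⊕ Q)
    ≡⟨ drop (bernDiff n ⊕ Q) (var n ⊕ Q) ⟩
  bernDiff n ⊕ Q ∎
  where
  Q = (var ⋆ exp half) n
  two-half : two ⊗ half ⊕ minusOne ≡ zero√5
  two-half = refl
  rearrange : ∀ t h H B x q → t ⊗ (H ⊕ h ⊗ x ⊕ h ⊗ q) ⊕ neg√5 one√5 ⊗ (B ⊕ x)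
              ≡ t ⊗ H ⊕ neg√5 one√5 ⊗ B ⊕ q ⊕ (t ⊗ h ⊕ neg√5 one√5) ⊗ (x ⊕ q)
  rearrange = solve-∀ ℚ√5-ring
  drop : ∀ a y → a ⊕ zero√5 ⊗ y ≡ a
  drop = solve-∀ ℚ√5-ring

twoSinhHalf-⋆-exp-half : twoSinhHalf ⋆ exp half ≋ exp one√5 ⊞ minusOne · δ₀
twoSinhHalf-⋆-exp-half n = begin
  (twoSinhHalf ⋆ exp half) n
    ≡⟨ ⋆-distribʳ-⊞ (exp half) (minusOne · exp (neg√5 half)) (exp half) n ⟩
  (exp half ⋆ exp half) n ⊕ (minusOne · exp (neg√5 half) ⋆ exp half) n
    ≡⟨ cong₂ _⊕_ (exp-⋆-exp half half n)
                 (trans (⋆-·ˡ minusOne (exp (neg√5 half)) (exp half) n)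
                        (cong (minusOne ⊗_) (trans (exp-⋆-exp (neg√5 half) half n) (exp-zero n)))) ⟩
  exp one√5 n ⊕ minusOne ⊗ δ₀ n ∎

bernDiff-⋆-twoSinhHalf : bernDiff ⋆ twoSinhHalf ≋ var
bernDiff-⋆-twoSinhHalf n = begin
  (bernDiff ⋆ twoSinhHalf) n                          ≡⟨ sym (⋆-exp-cancelʳ (bernDiff ⋆ twoSinhHalf) half n) ⟩
  (bernDiff ⋆ twoSinhHalf ⋆ exp half ⋆ exp (neg√5 half)) n
    ≡⟨ ⋆-congˡ (exp (neg√5 half)) times-exp-half n ⟩
  (var ⋆ exp half ⋆ exp (neg√5 half)) n               ≡⟨ ⋆-exp-cancelʳ var half n ⟩
  var n                                               ∎
  where
  times-exp-half : bernDiff ⋆ twoSinhHalf ⋆ exp half ≋ var ⋆ exp half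
  times-exp-half k = begin
    (bernDiff ⋆ twoSinhHalf ⋆ exp half) k                ≡⟨ ⋆-assoc bernDiff twoSinhHalf (exp half) k ⟩
    (bernDiff ⋆ (twoSinhHalf ⋆ exp half)) k              ≡⟨ ⋆-congʳ bernDiff twoSinhHalf-⋆-exp-half k ⟩
    (bernDiff ⋆ (exp one√5 ⊞ minusOne · δ₀)) k           ≡⟨ ⋆-distribˡ-⊞ bernDiff (exp one√5) (minusOne · δ₀) k ⟩
    (bernDiff ⋆ exp one√5) k ⊕ (bernDiff ⋆ minusOne · δ₀) k
      ≡⟨ cong₂ _⊕_ (bernDiff-⋆-exp-one k)
                   (trans (⋆-·ʳ minusOne bernDiff δ₀ k) (cong (minusOne ⊗_) (⋆-identityʳ bernDiff k))) ⟩
    bernDiff k ⊕ (var ⋆ exp half) k ⊕ minusOne ⊗ bernDiff k ≡⟨ cancel (bernDiff k) ((var ⋆ exp half) k) ⟩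
    (var ⋆ exp half) k                                   ∎
    where
    cancel : ∀ a q → a ⊕ q ⊕ neg√5 one√5 ⊗ a ≡ q
    cancel = solve-∀ ℚ√5-ring

-- Fibonacci numbers F₄ₖ

fib-+8 : ∀ j → fib (8 ℕ.+ j) ℕ.+ fib j ≡ 7 ℕ.* fib (4 ℕ.+ j)
fib-+8 j = unfolded (fib (suc j)) (fib j)
  where
  unfolded : ∀ a b → let f₂ = a ℕ.+ b ; f₃ = f₂ ℕ.+ a ; f₄ = f₃ ℕ.+ f₂ ; f₅ = f₄ ℕ.+ f₃
                         f₆ = f₅ ℕ.+ f₄ ; f₇ = f₆ ℕ.+ f₅ ; f₈ = f₇ ℕ.+ f₆
                     in f₈ ℕ.+ b ≡ 7 ℕ.* f₄
  unfolded = ℕ-Solver.solve-∀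

second-order-recurrence-unique :
  ∀ {A : Set} (step : A → A → A) (u v : ℕ → A) →
  (∀ k → u (suc (suc k)) ≡ step (u (suc k)) (u k)) →
  (∀ k → v (suc (suc k)) ≡ step (v (suc k)) (v k)) →
  u 0 ≡ v 0 → u 1 ≡ v 1 → ∀ k → u k ≡ v k
second-order-recurrence-unique step u v u-rec v-rec u₀≡v₀ u₁≡v₁ k = proj₁ (consecutive k)
  where
  consecutive : ∀ k → u k ≡ v k × u (suc k) ≡ v (suc k)
  consecutive zero = u₀≡v₀ , u₁≡v₁
  consecutive (suc k) with consecutive k
  ... | uₖ≡vₖ , uₖ₊₁≡vₖ₊₁ =
    uₖ₊₁≡vₖ₊₁ , trans (u-rec k) (trans (cong₂ step uₖ₊₁≡vₖ₊₁ uₖ≡vₖ) (sym (v-rec k)))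

fib4 : Seq
fib4 k = ιℕ (fib (4 ℕ.* k))

fib4-recurrence : ∀ k → fib4 (suc (suc k)) ≡ ιℕ 7 ⊗ fib4 (suc k) ⊕ minusOne ⊗ fib4 k
fib4-recurrence k = begin
  ιℕ a                               ≡⟨ add-subtract (ιℕ a) (ιℕ b) ⟩
  ιℕ a ⊕ ιℕ b ⊕ minusOne ⊗ ιℕ b      ≡⟨ cong (λ x → ι x ⊕ minusOne ⊗ ιℕ b) (sym (ℕ→ℚ-+ a b)) ⟩
  ιℕ (a ℕ.+ b) ⊕ minusOne ⊗ ιℕ b     ≡⟨ cong (λ x → ιℕ x ⊕ minusOne ⊗ ιℕ b) a+b≡7c ⟩
  ιℕ (7 ℕ.* c) ⊕ minusOne ⊗ ιℕ b
    ≡⟨ cong (λ x → x ⊕ minusOne ⊗ ιℕ b) (trans (cong ι (ℕ→ℚ-* 7 c)) (ι-* (ℕ→ℚ 7) (ℕ→ℚ c))) ⟩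
  ιℕ 7 ⊗ ιℕ c ⊕ minusOne ⊗ ιℕ b      ∎
  where
  a = fib (4 ℕ.* suc (suc k))
  b = fib (4 ℕ.* k)
  c = fib (4 ℕ.* suc k)
  index₁ : 4 ℕ.* suc k ≡ 4 ℕ.+ 4 ℕ.* k
  index₁ = ℕP.*-suc 4 k
  index₂ : 4 ℕ.* suc (suc k) ≡ 8 ℕ.+ 4 ℕ.* k
  index₂ = trans (ℕP.*-suc 4 (suc k)) (cong (4 ℕ.+_) index₁)
  a+b≡7c : a ℕ.+ b ≡ 7 ℕ.* c
  a+b≡7c = trans (cong (λ i → fib i ℕ.+ b) index₂)
                 (trans (fib-+8 (4 ℕ.* k)) (cong (λ i → 7 ℕ.* fib i) (sym index₁)))
  add-subtract : ∀ x y → x ≡ x ⊕ y ⊕ neg√5 one√5 ⊗ y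
  add-subtract = solve-∀ ℚ√5-ring

sevenHalves invSqrt5 α β : ℚ√5
sevenHalves = ι (+ 7 ℚ./ 2)
invSqrt5 = ℚ.0ℚ + (+ 1 ℚ./ 5) √5
α = three√5 ⊗ half ⊕ sevenHalves
β = three√5 ⊗ neg√5 half ⊕ sevenHalves

binet : Seq
binet = invSqrt5 · (exp α ⊞ minusOne · exp β)

binet-recurrence : ∀ k → binet (suc (suc k)) ≡ ιℕ 7 ⊗ binet (suc k) ⊕ minusOne ⊗ binet k
binet-recurrence k = begin
  invSqrt5 ⊗ (α ⊗ (α ⊗ x) ⊕ minusOne ⊗ (β ⊗ (β ⊗ y)))
    ≡⟨ cong₂ (λ p q → invSqrt5 ⊗ (p ⊕ minusOne ⊗ q)) (sym (⊗-assoc α α x)) (sym (⊗-assoc β β y)) ⟩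
  invSqrt5 ⊗ (α ⊗ α ⊗ x ⊕ minusOne ⊗ (β ⊗ β ⊗ y))
    ≡⟨ cong₂ (λ p q → invSqrt5 ⊗ (p ⊗ x ⊕ minusOne ⊗ (q ⊗ y))) α-root β-root ⟩
  invSqrt5 ⊗ ((ιℕ 7 ⊗ α ⊕ minusOne) ⊗ x ⊕ minusOne ⊗ ((ιℕ 7 ⊗ β ⊕ minusOne) ⊗ y))
    ≡⟨ expand invSqrt5 (ιℕ 7) α β minusOne x y ⟩
  ιℕ 7 ⊗ binet (suc k) ⊕ minusOne ⊗ binet k ∎
  where
  x = exp α k
  y = exp β k
  α-root : α ⊗ α ≡ ιℕ 7 ⊗ α ⊕ minusOne
  α-root = refl
  β-root : β ⊗ β ≡ ιℕ 7 ⊗ β ⊕ minusOne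
  β-root = refl
  expand : ∀ s t a b m x y → s ⊗ ((t ⊗ a ⊕ m) ⊗ x ⊕ m ⊗ ((t ⊗ b ⊕ m) ⊗ y))
           ≡ t ⊗ (s ⊗ (a ⊗ x ⊕ m ⊗ (b ⊗ y))) ⊕ m ⊗ (s ⊗ (x ⊕ m ⊗ y))
  expand = solve-∀ ℚ√5-ring

fib4≋binet : fib4 ≋ binet
fib4≋binet = second-order-recurrence-unique (λ p q → ιℕ 7 ⊗ p ⊕ minusOne ⊗ q) fib4 binet
               fib4-recurrence binet-recurrence refl refl

binet≋convolution : binet ≋ invSqrt5 · (dilate three√5 twoSinhHalf ⋆ exp sevenHalves)
binet≋convolution n = cong (invSqrt5 ⊗_) (sym (begin
  (dilate three√5 twoSinhHalf ⋆ exp sevenHalves) n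
    ≡⟨ ⋆-congˡ (exp sevenHalves) dilated n ⟩
  ((exp (three√5 ⊗ half) ⊞ minusOne · exp (three√5 ⊗ neg√5 half)) ⋆ exp sevenHalves) n
    ≡⟨ ⋆-distribʳ-⊞ (exp (three√5 ⊗ half)) (minusOne · exp (three√5 ⊗ neg√5 half)) (exp sevenHalves) n ⟩
  (exp (three√5 ⊗ half) ⋆ exp sevenHalves) n ⊕ (minusOne · exp (three√5 ⊗ neg√5 half) ⋆ exp sevenHalves) n
    ≡⟨ cong₂ _⊕_ (exp-⋆-exp (three√5 ⊗ half) sevenHalves n)
                 (trans (⋆-·ˡ minusOne (exp (three√5 ⊗ neg√5 half)) (exp sevenHalves) n)
                        (cong (minusOne ⊗_) (exp-⋆-exp (three√5 ⊗ neg√5 half) sevenHalves n))) ⟩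
  exp α n ⊕ minusOne ⊗ exp β n ∎))
  where
  distribute : ∀ p u m v → p ⊗ (u ⊕ m ⊗ v) ≡ p ⊗ u ⊕ m ⊗ (p ⊗ v)
  distribute = solve-∀ ℚ√5-ring
  dilated : dilate three√5 twoSinhHalf ≋ exp (three√5 ⊗ half) ⊞ minusOne · exp (three√5 ⊗ neg√5 half)
  dilated k = trans (distribute (three√5 ^√5 k) (exp half k) minusOne (exp (neg√5 half) k))
                    (cong₂ (λ a b → a ⊕ minusOne ⊗ b) (dilate-exp three√5 half k) (dilate-exp three√5 (neg√5 half) k))

lhs-as-convolution : ∀ n → lhs n ≡ (fib4 ⋆ dilate three√5 bernDiff) n
lhs-as-convolution n = sum√5-cong n (λ k _ →
  trans (cong (λ x → binom n k ⊗ three√5 ^√5 (n ∸ k) ⊗ x ⊗ fib4 k ⊗ bern (n ∸ k)) (ι-two^1- (n ∸ k)))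
        (regroup (binom n k) (three√5 ^√5 (n ∸ k)) two (half ^√5 (n ∸ k)) (fib4 k) (bern (n ∸ k))))
  where
  ι-two^1- : ∀ j → ι (two^1- j ℚ.- ℚ.1ℚ) ≡ two ⊗ half ^√5 j ⊕ minusOne
  ι-two^1- j = cong (_⊕ minusOne) (trans (ι-* (ℕ→ℚ 2) (½ ^ℚ j)) (cong (two ⊗_) (ι-^ ½ j)))
  regroup : ∀ c p t q f b → c ⊗ p ⊗ (t ⊗ q ⊕ neg√5 one√5) ⊗ f ⊗ b
            ≡ c ⊗ f ⊗ (p ⊗ (t ⊗ (q ⊗ b) ⊕ neg√5 one√5 ⊗ b))
  regroup = solve-∀ ℚ√5-ring

fib4-⋆-dilate-bernDiff : fib4 ⋆ dilate three√5 bernDiff ≋ (invSqrt5 ⊗ three√5) · (exp sevenHalves ⋆ var)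
fib4-⋆-dilate-bernDiff n = begin
  (fib4 ⋆ A) n                                   ≡⟨ ⋆-comm fib4 A n ⟩
  (A ⋆ fib4) n                                   ≡⟨ ⋆-congʳ A (λ k → trans (fib4≋binet k) (binet≋convolution k)) n ⟩
  (A ⋆ invSqrt5 · (S ⋆ exp sevenHalves)) n       ≡⟨ ⋆-·ʳ invSqrt5 A (S ⋆ exp sevenHalves) n ⟩
  invSqrt5 ⊗ (A ⋆ (S ⋆ exp sevenHalves)) n       ≡⟨ cong (invSqrt5 ⊗_) (sym (⋆-assoc A S (exp sevenHalves) n)) ⟩
  invSqrt5 ⊗ (A ⋆ S ⋆ exp sevenHalves) n         ≡⟨ cong (invSqrt5 ⊗_) (⋆-congˡ (exp sevenHalves) A⋆S n) ⟩
  invSqrt5 ⊗ (three√5 · var ⋆ exp sevenHalves) n ≡⟨ cong (invSqrt5 ⊗_) (⋆-·ˡ three√5 var (exp sevenHalves) n) ⟩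
  invSqrt5 ⊗ (three√5 ⊗ (var ⋆ exp sevenHalves) n)
    ≡⟨ sym (⊗-assoc invSqrt5 three√5 ((var ⋆ exp sevenHalves) n)) ⟩
  invSqrt5 ⊗ three√5 ⊗ (var ⋆ exp sevenHalves) n ≡⟨ cong (invSqrt5 ⊗ three√5 ⊗_) (⋆-comm var (exp sevenHalves) n) ⟩
  invSqrt5 ⊗ three√5 ⊗ (exp sevenHalves ⋆ var) n ∎
  where
  A = dilate three√5 bernDiff
  S = dilate three√5 twoSinhHalf
  A⋆S : A ⋆ S ≋ three√5 · var
  A⋆S k = trans (dilate-⋆ three√5 bernDiff twoSinhHalf k)
                (trans (cong (three√5 ^√5 k ⊗_) (bernDiff-⋆-twoSinhHalf k)) (dilate-var three√5 k))

rhs-expanded : ∀ n → rhs n ≡ ιℕ 3 ⊗ (ιℕ n ⊗ sevenHalves ^√5 (n ∸ 1))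
rhs-expanded n = begin
  ι (ℕ→ℚ (3 ℕ.* n) ℚ.* r ^ℚ (n ∸ 1))          ≡⟨ cong (λ x → ι (x ℚ.* r ^ℚ (n ∸ 1))) (ℕ→ℚ-* 3 n) ⟩
  ι (ℕ→ℚ 3 ℚ.* ℕ→ℚ n ℚ.* r ^ℚ (n ∸ 1))        ≡⟨ ι-* (ℕ→ℚ 3 ℚ.* ℕ→ℚ n) (r ^ℚ (n ∸ 1)) ⟩
  ι (ℕ→ℚ 3 ℚ.* ℕ→ℚ n) ⊗ ι (r ^ℚ (n ∸ 1))      ≡⟨ cong₂ _⊗_ (ι-* (ℕ→ℚ 3) (ℕ→ℚ n)) (ι-^ r (n ∸ 1)) ⟩
  ιℕ 3 ⊗ ιℕ n ⊗ sevenHalves ^√5 (n ∸ 1)       ≡⟨ ⊗-assoc (ιℕ 3) (ιℕ n) (sevenHalves ^√5 (n ∸ 1)) ⟩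
  ιℕ 3 ⊗ (ιℕ n ⊗ sevenHalves ^√5 (n ∸ 1))     ∎
  where r = + 7 ℚ./ 2

corollary7 : (n : ℕ) → lhs n ≡ rhs n
corollary7 n = begin
  lhs n                                              ≡⟨ lhs-as-convolution n ⟩
  (fib4 ⋆ dilate three√5 bernDiff) n                 ≡⟨ fib4-⋆-dilate-bernDiff n ⟩
  invSqrt5 ⊗ three√5 ⊗ (exp sevenHalves ⋆ var) n     ≡⟨ cong (invSqrt5 ⊗ three√5 ⊗_) (exp-⋆-var sevenHalves n) ⟩
  ιℕ 3 ⊗ (ιℕ n ⊗ sevenHalves ^√5 (n ∸ 1))            ≡⟨ sym (rhs-expanded n) ⟩
  rhs n                                              ∎
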